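{- Let $F(X,Y)$ be a CNF formula, $C$ a quantified clause of $F$ and $B\neq C$ another clause of $F$ such that $C_{\vec{q}}$ is implied by $B_{\vec{q}}$ for an assignment $\vec{q}$ (so the D-sequent $(\vec{q},\{B\},C)$ holds). Then this D-sequent has the scale-down property: for every assignment $\vec{q}\,'\supseteq\vec{q}$, the D-sequent $(\vec{q}\,',\{B\},C)$ holds for $\exists X[F]$.
   Context: Formulas are CNF over Boolean variables, viewed as sets of clauses; $X,Y$ are disjoint variable sets; a clause is quantified if it contains a variable of $X$. An assignment is a map from a set of variables to $\{0,1\}$; $\vec{q}\subseteq\vec{q}\,'$ means $\vec{q}\,'$ assigns all variables of $\vec{q}$ with the same values. $C_{\vec{q}}=1$ if $\vec{q}$ satisfies $C$, else $C$ minus falsified literals; $F_{\vec{q}}$ removes satisfied clauses and replaces others by their restriction. $C$ is redundant in $\exists X[F]$ if $\exists X[F]\equiv\exists X[F\setminus\{C\}]$ (equivalence as functions of free variables). A D-sequent $(\vec{q},U,C)$ holds for $\exists X[F]$ if $C_{\vec{q}}$ is redundant in $\exists X[F_{\vec{q}}]$. -}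

module Defs where

open import Data.Nat using (ℕ)
open import Data.Bool using (Bool; true; false; if_then_else_; _∨_)
open import Data.Maybe using (Maybe; just; nothing)
import Data.Maybe
open import Data.Product using (_×_; _,_; proj₁; proj₂; ∃)
open import Data.List using (List; []; _∷_; mapMaybe; length; lookup; removeAt)
open import Data.List.Relation.Unary.Any using (Any)
open import Data.List.Relation.Unary.All using (All)
open import Data.Unit using (⊤)
open import Data.Empty using (⊥)
open import Data.Fin using (Fin)
open import Relation.Binary.PropositionalEquality using (_≡_)
open import Function.Bundles using (_⇔_)

Var : Set
Var = ℕ

-- A literal: a variable with a polarity (true = positive literal v, false = ¬v).
Literal : Set
Literal = Var × Bool

var : Literal → Var
var = proj₁

-- A clause is a disjunction of literals; a CNF formula is a collection of clauses.
-- Formulas are lists so that individual clause occurrences (C, B) can be named by position.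
Clause : Set
Clause = List Literal

CNF : Set
CNF = List Clause

VarSet : Set
VarSet = Var → Bool

Assignment : Set
Assignment = Var → Maybe Bool

Total : Set
Total = Var → Bool

_⊑_ : Assignment → Assignment → Set
q ⊑ q' = ∀ v b → q v ≡ just b → q' v ≡ just b

litVal : Total → Literal → Bool
litVal a (v , true)  = a v
litVal a (v , false) = if a v then false else true

SatClause : Total → Clause → Set
SatClause a C = Any (λ l → litVal a l ≡ true) C

SatCNF : Total → CNF → Set
SatCNF a F = All (SatClause a) F

-- Restriction of a clause by a partial assignment q:
-- nothing represents the constant 1 (q satisfies C); otherwise just (C minus literals falsified by q).
restrictClause : Assignment → Clause → Maybe Clause
restrictClause q [] = just []
restrictClause q ((v , p) ∷ C) with q v
... | nothing = Data.Maybe.map ((v , p) ∷_) (restrictClause q C)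
... | just b  = if (if b then p else (if p then false else true))
                  then nothing
                  else restrictClause q C

restrictCNF : Assignment → CNF → CNF
restrictCNF q F = mapMaybe (restrictClause q) F

SatRClause : Total → Maybe Clause → Set
SatRClause a nothing  = ⊤
SatRClause a (just C) = SatClause a C

merge : VarSet → Total → Total → Total
merge X x y v = if X v then x v else y v

-- ∃X[G] evaluated at an assignment y of the free (non-X) variables.
ExistsSat : VarSet → CNF → Total → Set
ExistsSat X G y = ∃ λ (x : Total) → SatCNF (merge X x y) G

Equiv : VarSet → CNF → CNF → Set
Equiv X G H = ∀ (y : Total) → ExistsSat X G y ⇔ ExistsSat X H y

-- The D-sequent (q, U, C) holds for ∃X[F], where C is the clause of F at position i:
-- C_q is redundant in ∃X[F_q], i.e. ∃X[F_q] ≡ ∃X[F_q ∖ {C_q}],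
-- and F_q ∖ {C_q} is (F ∖ {C})_q.  (The set U plays no role in the semantics.)
DSeqHolds : VarSet → (F : CNF) → Assignment → List (Fin (length F)) → Fin (length F) → Set
DSeqHolds X F q U i = Equiv X (restrictCNF q F) (restrictCNF q (removeAt F i))

Quantified : VarSet → Clause → Set
Quantified X C = Any (λ l → X (var l) ≡ true) C

Disjoint : VarSet → VarSet → Set
Disjoint X Y = ∀ v → X v ≡ true → Y v ≡ true → ⊥

VarsIn : VarSet → VarSet → CNF → Set
VarsIn X Y F = All (All (λ l → (X (var l) ∨ Y (var l)) ≡ true)) F

Implies : Maybe Clause → Maybe Clause → Set
Implies B C = ∀ (a : Total) → SatRClause a B → SatRClause a C

-- Evaluating the restriction C_q at a total assignment a is the same as evaluating C at
-- a overridden by q.  When q ⊑ q′, overriding by q after q′ changes nothing, so the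
-- implication B_q ⇒ C_q carries over to B_q′ ⇒ C_q′.  A clause implied by another clause
-- of a formula can be dropped without changing the satisfying assignments at all, hence
-- without changing ∃X[F_q′].
module Submission where

open import Defs
open import Data.Bool using (true; false; if_then_else_)
open import Data.Empty using (⊥-elim)
open import Data.Fin using (Fin; zero; suc)
open import Data.List using (List; []; _∷_; length; lookup; removeAt)
open import Data.List.Membership.Propositional using (_∈_)
open import Data.List.Membership.Propositional.Properties using (∈-lookup)
open import Data.List.Relation.Unary.All as All using (All; []; _∷_)
open import Data.List.Relation.Unary.Any as Any using (there)
open import Data.List.Relation.Unary.Any.Properties using (∷↔)
open import Data.Maybe using (just; nothing; fromMaybe)
import Data.Maybe as Maybe
open import Data.Product using (_×_; _,_; proj₂; map₂)
open import Data.Sum using (_⊎_; inj₁; inj₂)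
open import Data.Sum.Function.Propositional using (_⊎-⇔_)
open import Data.Unit using (⊤; tt)
open import Function using (_∘_)
open import Function.Bundles using (_⇔_; mk⇔; Equivalence)
open import Function.Construct.Composition using (_⇔-∘_)
open import Function.Construct.Symmetry using (⇔-sym)
open import Function.Construct.Identity using (⇔-id)
open import Function.Properties.Inverse using (↔⇒⇔)
open import Relation.Binary.PropositionalEquality
  using (_≡_; _≢_; _≗_; refl; sym; trans; cong)
open import Relation.Unary using (Pred)

override : Assignment → Total → Total
override q a v = fromMaybe (a v) (q v)

override-⊑ : ∀ {q q′} → q ⊑ q′ → ∀ a → override q (override q′ a) ≗ override q′ a
override-⊑ {q} q⊑q′ a v with q v in qv
... | nothing = refl
... | just b rewrite q⊑q′ v b qv = refl

override-just : ∀ q {v b} a → q v ≡ just b → override q a v ≡ b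
override-just q a qv rewrite qv = refl

override-nothing : ∀ q {v} a → q v ≡ nothing → override q a v ≡ a v
override-nothing q a qv rewrite qv = refl

litVal-cong : ∀ {f g : Total} l → f (var l) ≡ g (var l) → litVal f l ≡ litVal g l
litVal-cong (v , true)  fv≡gv = fv≡gv
litVal-cong (v , false) fv≡gv = cong (λ b → if b then false else true) fv≡gv

SatClause-cong : ∀ {f g : Total} → f ≗ g → ∀ C → SatClause f C ⇔ SatClause g C
SatClause-cong f≗g C = mk⇔ (Any.map (λ {l} → trans (sym (litVal-cong l (f≗g (var l))))))
                           (Any.map (λ {l} → trans (litVal-cong l (f≗g (var l)))))

SatRClause-map-∷ : ∀ a l r →
  SatRClause a (Maybe.map (l ∷_) r) ⇔ (litVal a l ≡ true ⊎ SatRClause a r)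
SatRClause-map-∷ a l nothing  = mk⇔ (λ _ → inj₂ tt) (λ _ → tt)
SatRClause-map-∷ a l (just C) = ⇔-sym (↔⇒⇔ (∷↔ _))

≡true-⇔ : ∀ {x y} → x ≡ y → (x ≡ true) ⇔ (y ≡ true)
≡true-⇔ x≡y = mk⇔ (trans (sym x≡y)) (trans x≡y)

true-⊎ : ∀ {b} {A : Set} → b ≡ true → ⊤ ⇔ (b ≡ true ⊎ A)
true-⊎ b≡true = mk⇔ (λ _ → inj₁ b≡true) (λ _ → tt)

false-⊎ : ∀ {b} {A : Set} → b ≡ false → A ⇔ (b ≡ true ⊎ A)
false-⊎ {A = A} refl = mk⇔ inj₂ drop
  where
  drop : false ≡ true ⊎ A → A
  drop (inj₂ x) = x

SatRClause-restrictClause-∷ : ∀ q a l C →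
  SatRClause a (restrictClause q (l ∷ C))
    ⇔ (litVal (override q a) l ≡ true ⊎ SatRClause a (restrictClause q C))
SatRClause-restrictClause-∷ q a (v , p) C with q v in qv
... | nothing =
  (≡true-⇔ (litVal-cong (v , p) (sym (override-nothing q a qv))) ⊎-⇔ ⇔-id _)
    ⇔-∘ SatRClause-map-∷ a (v , p) (restrictClause q C)
... | just true  with p
...   | true  = true-⊎ (override-just q a qv)
...   | false = false-⊎ (cong (λ b → if b then false else true) (override-just q a qv))
SatRClause-restrictClause-∷ q a (v , p) C | just false with p
...   | true  = false-⊎ (override-just q a qv)
...   | false = true-⊎ (cong (λ b → if b then false else true) (override-just q a qv))

SatRClause-restrictClause : ∀ q a C → SatRClause a (restrictClause q C) ⇔ SatClause (override q a) C
SatRClause-restrictClause q a []      = mk⇔ (λ ()) (λ ())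
SatRClause-restrictClause q a (l ∷ C) =
  ↔⇒⇔ (∷↔ _) ⇔-∘ ((⇔-id _ ⊎-⇔ SatRClause-restrictClause q a C) ⇔-∘ SatRClause-restrictClause-∷ q a l C)

SatRClause-restrictClause-⊑ : ∀ {q q′} → q ⊑ q′ → ∀ a C →
  SatRClause a (restrictClause q′ C) ⇔ SatRClause (override q′ a) (restrictClause q C)
SatRClause-restrictClause-⊑ {q} {q′} q⊑q′ a C =
  ⇔-sym (SatRClause-restrictClause q (override q′ a) C)
    ⇔-∘ (SatClause-cong (sym ∘ override-⊑ q⊑q′ a) C ⇔-∘ SatRClause-restrictClause q′ a C)

Implies-⊑ : ∀ {q q′} → q ⊑ q′ → ∀ B C →
  Implies (restrictClause q B) (restrictClause q C) → Implies (restrictClause q′ B) (restrictClause q′ C)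
Implies-⊑ {q′ = q′} q⊑q′ B C B⇒C a =
  from (SatRClause-restrictClause-⊑ q⊑q′ a C) ∘ B⇒C (override q′ a) ∘ to (SatRClause-restrictClause-⊑ q⊑q′ a B)
  where open Equivalence

SatCNF-restrictCNF-∷ : ∀ q a C F →
  SatCNF a (restrictCNF q (C ∷ F)) ⇔ (SatRClause a (restrictClause q C) × SatCNF a (restrictCNF q F))
SatCNF-restrictCNF-∷ q a C F with restrictClause q C
... | nothing = mk⇔ (tt ,_) proj₂
... | just _  = mk⇔ (λ { (satC ∷ satF) → satC , satF }) (λ (satC , satF) → satC ∷ satF)

SatCNF-restrictCNF : ∀ q a F → SatCNF a (restrictCNF q F) ⇔ All (λ C → SatRClause a (restrictClause q C)) F
SatCNF-restrictCNF q a []      = mk⇔ (λ _ → []) (λ _ → [])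
SatCNF-restrictCNF q a (C ∷ F) = mk⇔
  (λ sat → let satC , satF = to (SatCNF-restrictCNF-∷ q a C F) sat
           in satC ∷ to (SatCNF-restrictCNF q a F) satF)
  (λ { (satC ∷ satF) → from (SatCNF-restrictCNF-∷ q a C F) (satC , from (SatCNF-restrictCNF q a F) satF) })
  where open Equivalence

module _ {a p} {A : Set a} {P : Pred A p} where

  All-removeAt⁺ : ∀ {xs} i → All P xs → All P (removeAt xs i)
  All-removeAt⁺ zero    (_ ∷ pxs)  = pxs
  All-removeAt⁺ (suc i) (px ∷ pxs) = px ∷ All-removeAt⁺ i pxs

  All-removeAt⁻ : ∀ {xs} i → P (lookup xs i) → All P (removeAt xs i) → All P xs
  All-removeAt⁻ {_ ∷ _} zero    px pxs         = px ∷ pxs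
  All-removeAt⁻ {_ ∷ _} (suc i) px (px′ ∷ pxs) = px′ ∷ All-removeAt⁻ i px pxs

lookup-∈-removeAt : ∀ {a} {A : Set a} (xs : List A) {i j} → lookup xs j ≢ lookup xs i → lookup xs j ∈ removeAt xs i
lookup-∈-removeAt (x ∷ xs) {zero}  {zero}  xⱼ≢xᵢ = ⊥-elim (xⱼ≢xᵢ refl)
lookup-∈-removeAt (x ∷ xs) {zero}  {suc j} xⱼ≢xᵢ = ∈-lookup j
lookup-∈-removeAt (x ∷ xs) {suc i} {zero}  xⱼ≢xᵢ = Any.here refl
lookup-∈-removeAt (x ∷ xs) {suc i} {suc j} xⱼ≢xᵢ = there (lookup-∈-removeAt xs xⱼ≢xᵢ)

All-removeAt-implied : ∀ {a p} {A : Set a} {P : Pred A p} (xs : List A) {i j} →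
  lookup xs j ≢ lookup xs i → (P (lookup xs j) → P (lookup xs i)) →
  All P xs ⇔ All P (removeAt xs i)
All-removeAt-implied xs {i} xⱼ≢xᵢ Pxⱼ⇒Pxᵢ = mk⇔ (All-removeAt⁺ i)
  (λ pxs → All-removeAt⁻ i (Pxⱼ⇒Pxᵢ (All.lookup pxs (lookup-∈-removeAt xs xⱼ≢xᵢ))) pxs)

Equiv-≗ : ∀ X {G H} → (∀ a → SatCNF a G ⇔ SatCNF a H) → Equiv X G H
Equiv-≗ X G⇔H y = mk⇔ (map₂ (to (G⇔H _))) (map₂ (from (G⇔H _)))
  where open Equivalence

DSeqHolds-implied : ∀ X F q U {i j} → lookup F j ≢ lookup F i →
  Implies (restrictClause q (lookup F j)) (restrictClause q (lookup F i)) →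
  DSeqHolds X F q U i
DSeqHolds-implied X F q U {i} Cⱼ≢Cᵢ Cⱼ⇒Cᵢ = Equiv-≗ X λ a →
  ⇔-sym (SatCNF-restrictCNF q a (removeAt F i))
    ⇔-∘ (All-removeAt-implied F Cⱼ≢Cᵢ (Cⱼ⇒Cᵢ a) ⇔-∘ SatCNF-restrictCNF q a F)

lemma3 : (X Y : VarSet) → Disjoint X Y → (F : CNF) → VarsIn X Y F →
         (i j : Fin (length F)) → lookup F j ≢ lookup F i → Quantified X (lookup F i) →
         (q : Assignment) →
         Implies (restrictClause q (lookup F j)) (restrictClause q (lookup F i)) →
         (q′ : Assignment) → q ⊑ q′ → DSeqHolds X F q′ (j ∷ []) i
lemma3 X _ _ F _ i j B≢C _ _ B⇒C q′ q⊑q′ =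
  DSeqHolds-implied X F q′ (j ∷ []) B≢C (Implies-⊑ q⊑q′ (lookup F j) (lookup F i) B⇒C)
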